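{- Let $W=\langle W,\cdot,1_W\rangle$ be a monoid. Decorated-traversable functors form a strict monoidal category $\mathbf{DecTrav}_W$ with: objects the decorated-traversable functors; morphisms $T_1\Rightarrow T_2$ the natural transformations $\psi$ satisfying both $\psi_{W\times A}\circ\mathrm{dec}_{T_1}=\mathrm{dec}_{T_2}\circ\psi_A$ and $\mathrm{dist}^{T_2}_F\circ\psi_{FA}=\mathrm{map}_F(\psi_A)\circ\mathrm{dist}^{T_1}_F$ for every applicative $F$; tensor unit the identity functor with decoration $a\mapsto(1_W,a)$ and distribution the identity; and tensor product given by composition $T_1\circ T_2$, with decoration $$\mathrm{dec}_{T_1\circ T_2}:=\mathrm{map}_{T_1}\big(\mathrm{map}_{T_2}(\mathrm{join}_{W\times})\circ\sigma_{T_2}\big)\circ\mathrm{dec}_{T_1}\circ\mathrm{map}_{T_1}(\mathrm{dec}_{T_2})$$ and distribution $\mathrm{dist}^{T_1\circ T_2}_F:=\mathrm{dist}^{T_1}_F\circ\mathrm{map}_{T_1}(\mathrm{dist}^{T_2}_F)$. (In particular these unit and composite structures are again decorated-traversable functors.)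
   Context: All functors are endofunctors of $\mathbf{Set}$; $\mathrm{map}_F$ is the functor action; $\mathbb 1$ is the identity functor. Applicative functor: $F$ with $\mathrm{pure}:A\to FA$ and $\circledast:F(A\to B)\to FA\to FB$ satisfying $\mathrm{pure}\,\mathrm{id}\circledast a=a$; $\mathrm{pure}\,f\circledast\mathrm{pure}\,a=\mathrm{pure}(fa)$; $g\circledast(f\circledast a)=\mathrm{pure}(\circ)\circledast g\circledast f\circledast a$; $f\circledast\mathrm{pure}\,a=\mathrm{pure}(\lambda h.\,h\,a)\circledast f$; $\mathrm{map}_Ff\,x=\mathrm{pure}f\circledast x$. Identity and composites of applicatives are applicative; an applicative morphism is a natural transformation preserving $\mathrm{pure}$ and $\circledast$. On $W\times-$: $\mathrm{extr}(w,a)=a$, $\mathrm{dup}(w,a)=(w,(w,a))$, $\mathrm{join}_{W\times}(w_1,(w_2,a))=(w_1\cdot w_2,a)$; strength $\sigma_G(w,x)=\mathrm{map}_G(\lambda a.(w,a))x:W\times GA\to G(W\times A)$. A decorated functor $T$ has natural $\mathrm{dec}_T:TA\to T(W\times A)$ with $\mathrm{map}_T\mathrm{extr}\circ\mathrm{dec}_T=\mathrm{id}$ and $\mathrm{map}_T\mathrm{dup}\circ\mathrm{dec}_T=\mathrm{dec}_T\circ\mathrm{dec}_T$. A traversable functor $T$ has, for each applicative $F$, $\mathrm{dist}^T_F:T(FA)\to F(TA)$ natural in $A$, with $\mathrm{dist}^T_{\mathbb 1}=\mathrm{id}$, $\mathrm{dist}^T_{F\circ G}=\mathrm{map}_F(\mathrm{dist}^T_G)\circ\mathrm{dist}^T_F$,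 and $\phi\circ\mathrm{dist}^T_F=\mathrm{dist}^T_G\circ\mathrm{map}_T\phi$ for applicative morphisms $\phi:F\Rightarrow G$. A decorated-traversable functor is both, and additionally satisfies $\mathrm{map}_F(\mathrm{dec}_T)\circ\mathrm{dist}^T_F=\mathrm{dist}^T_F\circ\mathrm{map}_T(\sigma_F)\circ\mathrm{dec}_T$ as maps $T(FA)\to F(T(W\times A))$. -}

module Defs where

open import Level using (0ℓ)
open import Data.Product using (_×_; _,_; proj₁; proj₂; map₂)
open import Function using (_∘_; id)
open import Relation.Binary.PropositionalEquality using (_≡_)

record RawApplicative : Set₁ where
  infixl 5 _⊛_
  field
    F    : Set → Set
    map  : ∀ {A B : Set} → (A → B) → F A → F B
    pure : ∀ {A : Set} → A → F A
    _⊛_  : ∀ {A B : Set} → F (A → B) → F A → F B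

record IsApplicative (Ap : RawApplicative) : Set₁ where
  open RawApplicative Ap
  field
    identity     : ∀ {A : Set} (a : F A) → pure id ⊛ a ≡ a
    homomorphism : ∀ {A B : Set} (f : A → B) (a : A) → pure f ⊛ pure a ≡ pure (f a)
    composition  : ∀ {A B C : Set} (g : F (B → C)) (f : F (A → B)) (a : F A) →
                   g ⊛ (f ⊛ a) ≡ pure (λ (g′ : B → C) (f′ : A → B) → g′ ∘ f′) ⊛ g ⊛ f ⊛ a
    interchange  : ∀ {A B : Set} (f : F (A → B)) (a : A) →
                   f ⊛ pure a ≡ pure (λ (h : A → B) → h a) ⊛ f
    map-pure     : ∀ {A B : Set} (f : A → B) (x : F A) → map f x ≡ pure f ⊛ x

idApp : RawApplicative
idApp = record { F = λ A → A ; map = λ f → f ; pure = λ a → a ; _⊛_ = λ f a → f a }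

_∘App_ : RawApplicative → RawApplicative → RawApplicative
Fa ∘App Ga = record
  { F    = λ A → Fᵣ.F (Gᵣ.F A)
  ; map  = λ f → Fᵣ.map (Gᵣ.map f)
  ; pure = λ a → Fᵣ.pure (Gᵣ.pure a)
  ; _⊛_  = λ {A} {B} h x → Fᵣ.pure (λ (g : Gᵣ.F (A → B)) (y : Gᵣ.F A) → g Gᵣ.⊛ y) Fᵣ.⊛ h Fᵣ.⊛ x
  }
  where
  module Fᵣ = RawApplicative Fa
  module Gᵣ = RawApplicative Ga

record IsApplicativeMorphism (Fa Ga : RawApplicative)
       (φ : ∀ {A : Set} → RawApplicative.F Fa A → RawApplicative.F Ga A) : Set₁ where
  private
    module Fᵣ = RawApplicative Fa
    module Gᵣ = RawApplicative Ga
  field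
    natural  : ∀ {A B : Set} (f : A → B) (x : Fᵣ.F A) → φ (Fᵣ.map f x) ≡ Gᵣ.map f (φ x)
    pure-pres : ∀ {A : Set} (a : A) → φ (Fᵣ.pure a) ≡ Gᵣ.pure a
    ap-pres  : ∀ {A B : Set} (h : Fᵣ.F (A → B)) (x : Fᵣ.F A) → φ (h Fᵣ.⊛ x) ≡ φ h Gᵣ.⊛ φ x

extr : ∀ {W A : Set} → W × A → A
extr (w , a) = a

dup : ∀ {W A : Set} → W × A → W × (W × A)
dup (w , a) = (w , (w , a))

join : ∀ {W A : Set} → (W → W → W) → W × (W × A) → W × A
join _·_ (w₁ , (w₂ , a)) = (w₁ · w₂ , a)

σ : ∀ {W : Set} {G : Set → Set} → (∀ {A B : Set} → (A → B) → G A → G B) →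
    ∀ {A : Set} → W × G A → G (W × A)
σ mapG (w , x) = mapG (λ a → (w , a)) x

record DecTravOps (W : Set) (T : Set → Set) : Set₁ where
  field
    map  : ∀ {A B : Set} → (A → B) → T A → T B
    dec  : ∀ {A : Set} → T A → T (W × A)
    dist : (Ap : RawApplicative) → IsApplicative Ap →
           ∀ {A : Set} → T (RawApplicative.F Ap A) → RawApplicative.F Ap (T A)

record IsDecTrav {W : Set} {T : Set → Set} (S : DecTravOps W T) : Set₁ where
  open DecTravOps S
  field
    map-id : ∀ {A : Set} (x : T A) → map id x ≡ x
    map-∘  : ∀ {A B C : Set} (g : B → C) (f : A → B) (x : T A) → map (g ∘ f) x ≡ map g (map f x)
    dec-natural : ∀ {A B : Set} (f : A → B) (x : T A) → map (map₂ f) (dec x) ≡ dec (map f x)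
    dec-extr    : ∀ {A : Set} (x : T A) → map extr (dec x) ≡ x
    dec-dup     : ∀ {A : Set} (x : T A) → map dup (dec x) ≡ dec (dec x)
    dist-natural : (Ap : RawApplicative) (p : IsApplicative Ap) →
                   ∀ {A B : Set} (f : A → B) (x : T (RawApplicative.F Ap A)) →
                   RawApplicative.map Ap (map f) (dist Ap p x) ≡ dist Ap p (map (RawApplicative.map Ap f) x)
    dist-id : (p : IsApplicative idApp) → ∀ {A : Set} (x : T A) → dist idApp p x ≡ x
    dist-∘  : (Fa Ga : RawApplicative) (pF : IsApplicative Fa) (pG : IsApplicative Ga)
              (pFG : IsApplicative (Fa ∘App Ga)) →
              ∀ {A : Set} (x : T (RawApplicative.F Fa (RawApplicative.F Ga A))) →
              dist (Fa ∘App Ga) pFG x ≡ RawApplicative.map Fa (dist Ga pG) (dist Fa pF x)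
    dist-morphism : (Fa Ga : RawApplicative) (pF : IsApplicative Fa) (pG : IsApplicative Ga)
                    (φ : ∀ {A : Set} → RawApplicative.F Fa A → RawApplicative.F Ga A) →
                    IsApplicativeMorphism Fa Ga φ →
                    ∀ {A : Set} (x : T (RawApplicative.F Fa A)) →
                    φ (dist Fa pF x) ≡ dist Ga pG (map φ x)
    dec-dist : (Ap : RawApplicative) (p : IsApplicative Ap) →
               ∀ {A : Set} (x : T (RawApplicative.F Ap A)) →
               RawApplicative.map Ap dec (dist Ap p x) ≡ dist Ap p (map (σ (RawApplicative.map Ap)) (dec x))

record DTObj (W : Set) : Set₁ where
  field
    Carrier : Set → Set
    ops     : DecTravOps W Carrier
    isDT    : IsDecTrav ops
open DTObj public

NatFam : (Set → Set) → (Set → Set) → Set₁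
NatFam T₁ T₂ = ∀ {A : Set} → T₁ A → T₂ A

record IsDTHom {W : Set} {T₁ T₂ : Set → Set} (S₁ : DecTravOps W T₁) (S₂ : DecTravOps W T₂)
               (ψ : NatFam T₁ T₂) : Set₁ where
  private
    module S₁ = DecTravOps S₁
    module S₂ = DecTravOps S₂
  field
    natural  : ∀ {A B : Set} (f : A → B) (x : T₁ A) → ψ (S₁.map f x) ≡ S₂.map f (ψ x)
    hom-dec  : ∀ {A : Set} (x : T₁ A) → ψ (S₁.dec x) ≡ S₂.dec (ψ x)
    hom-dist : (Ap : RawApplicative) (p : IsApplicative Ap) →
               ∀ {A : Set} (x : T₁ (RawApplicative.F Ap A)) →
               S₂.dist Ap p (ψ x) ≡ RawApplicative.map Ap ψ (S₁.dist Ap p x)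

unitOps : {W : Set} → W → DecTravOps W (λ A → A)
unitOps ε = record { map = λ f → f ; dec = λ a → (ε , a) ; dist = λ Ap p x → x }

tensorOps : {W : Set} → (W → W → W) → {T₁ T₂ : Set → Set} →
            DecTravOps W T₁ → DecTravOps W T₂ → DecTravOps W (λ A → T₁ (T₂ A))
tensorOps _·_ S₁ S₂ = record
  { map  = λ f → S₁.map (S₂.map f)
  ; dec  = λ x → S₁.map (S₂.map (join _·_) ∘ σ S₂.map) (S₁.dec (S₁.map S₂.dec x))
  ; dist = λ Ap p x → S₁.dist Ap p (S₁.map (S₂.dist Ap p) x)
  }
  where
  module S₁ = DecTravOps S₁
  module S₂ = DecTravOps S₂

hcomp : (T₁ T₁′ T₂ T₂′ : Set → Set) → (∀ {A B : Set} → (A → B) → T₁ A → T₁ B) →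
        NatFam T₁ T₁′ → NatFam T₂ T₂′ → NatFam (λ A → T₁ (T₂ A)) (λ A → T₁′ (T₂′ A))
hcomp T₁ T₁′ T₂ T₂′ map₁ ψ φ x = ψ (map₁ φ x)

record _≈Ops_ {W : Set} {T : Set → Set} (S S′ : DecTravOps W T) : Set₁ where
  private
    module S  = DecTravOps S
    module S′ = DecTravOps S′
  field
    map-≈  : ∀ {A B : Set} (f : A → B) (x : T A) → S.map f x ≡ S′.map f x
    dec-≈  : ∀ {A : Set} (x : T A) → S.dec x ≡ S′.dec x
    dist-≈ : (Ap : RawApplicative) (p : IsApplicative Ap) →
             ∀ {A : Set} (x : T (RawApplicative.F Ap A)) → S.dist Ap p x ≡ S′.dist Ap p x

record DecTravStrictMonoidal {W : Set} (_·_ : W → W → W) (ε : W) : Set₂ where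
  private
    _⊗_ : {T₁ T₂ : Set → Set} → DecTravOps W T₁ → DecTravOps W T₂ → DecTravOps W (λ A → T₁ (T₂ A))
    _⊗_ = tensorOps _·_
    mp : (T : DTObj W) → ∀ {A B : Set} → (A → B) → Carrier T A → Carrier T B
    mp T = DecTravOps.map (ops T)
  field
    unit-isDecTrav : IsDecTrav (unitOps ε)
    ⊗-isDecTrav    : (T₁ T₂ : DTObj W) → IsDecTrav (ops T₁ ⊗ ops T₂)
    id-isHom : (T : DTObj W) → IsDTHom (ops T) (ops T) (λ x → x)
    ∘-isHom  : (T₁ T₂ T₃ : DTObj W) (ψ : NatFam (Carrier T₂) (Carrier T₃)) (φ : NatFam (Carrier T₁) (Carrier T₂)) →
               IsDTHom (ops T₂) (ops T₃) ψ → IsDTHom (ops T₁) (ops T₂) φ →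
               IsDTHom (ops T₁) (ops T₃) (λ x → ψ (φ x))
    idˡ   : (T₁ T₂ : DTObj W) (ψ : NatFam (Carrier T₁) (Carrier T₂)) → IsDTHom (ops T₁) (ops T₂) ψ →
            ∀ {A : Set} (x : Carrier T₁ A) → (λ y → y) (ψ x) ≡ ψ x
    idʳ   : (T₁ T₂ : DTObj W) (ψ : NatFam (Carrier T₁) (Carrier T₂)) → IsDTHom (ops T₁) (ops T₂) ψ →
            ∀ {A : Set} (x : Carrier T₁ A) → ψ ((λ y → y) x) ≡ ψ x
    assoc : (T₁ T₂ T₃ T₄ : DTObj W) (χ : NatFam (Carrier T₃) (Carrier T₄))
            (ψ : NatFam (Carrier T₂) (Carrier T₃)) (φ : NatFam (Carrier T₁) (Carrier T₂)) →
            IsDTHom (ops T₃) (ops T₄) χ → IsDTHom (ops T₂) (ops T₃) ψ → IsDTHom (ops T₁) (ops T₂) φ →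
            ∀ {A : Set} (x : Carrier T₁ A) → (λ y → χ (ψ y)) (φ x) ≡ χ ((λ y → ψ (φ y)) x)
    ⊗-isHom : (T₁ T₁′ T₂ T₂′ : DTObj W)
              (ψ : NatFam (Carrier T₁) (Carrier T₁′)) (φ : NatFam (Carrier T₂) (Carrier T₂′)) →
              IsDTHom (ops T₁) (ops T₁′) ψ → IsDTHom (ops T₂) (ops T₂′) φ →
              IsDTHom (ops T₁ ⊗ ops T₂) (ops T₁′ ⊗ ops T₂′) (hcomp (Carrier T₁) (Carrier T₁′) (Carrier T₂) (Carrier T₂′) (mp T₁) ψ φ)
    ⊗-id    : (T₁ T₂ : DTObj W) → ∀ {A : Set} (x : Carrier T₁ (Carrier T₂ A)) →
              hcomp (Carrier T₁) (Carrier T₁) (Carrier T₂) (Carrier T₂) (mp T₁) (λ y → y) (λ y → y) x ≡ x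
    ⊗-∘     : (T₁ T₁′ T₁″ T₂ T₂′ T₂″ : DTObj W)
              (ψ : NatFam (Carrier T₁) (Carrier T₁′)) (ψ′ : NatFam (Carrier T₁′) (Carrier T₁″))
              (φ : NatFam (Carrier T₂) (Carrier T₂′)) (φ′ : NatFam (Carrier T₂′) (Carrier T₂″)) →
              IsDTHom (ops T₁) (ops T₁′) ψ → IsDTHom (ops T₁′) (ops T₁″) ψ′ →
              IsDTHom (ops T₂) (ops T₂′) φ → IsDTHom (ops T₂′) (ops T₂″) φ′ →
              ∀ {A : Set} (x : Carrier T₁ (Carrier T₂ A)) →
              hcomp (Carrier T₁) (Carrier T₁″) (Carrier T₂) (Carrier T₂″) (mp T₁) (λ y → ψ′ (ψ y)) (λ y → φ′ (φ y)) x
                ≡ hcomp (Carrier T₁′) (Carrier T₁″) (Carrier T₂′) (Carrier T₂″) (mp T₁′) ψ′ φ′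
                    (hcomp (Carrier T₁) (Carrier T₁′) (Carrier T₂) (Carrier T₂′) (mp T₁) ψ φ x)
    unitˡ-obj : (T : DTObj W) → (unitOps ε ⊗ ops T) ≈Ops ops T
    unitʳ-obj : (T : DTObj W) → (ops T ⊗ unitOps ε) ≈Ops ops T
    assoc-obj : (T₁ T₂ T₃ : DTObj W) → ((ops T₁ ⊗ ops T₂) ⊗ ops T₃) ≈Ops (ops T₁ ⊗ (ops T₂ ⊗ ops T₃))
    unitˡ-hom : (T T′ : DTObj W) (ψ : NatFam (Carrier T) (Carrier T′)) → IsDTHom (ops T) (ops T′) ψ →
                ∀ {A : Set} (x : Carrier T A) → hcomp (λ B → B) (λ B → B) (Carrier T) (Carrier T′) (λ f → f) (λ y → y) ψ x ≡ ψ x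
    unitʳ-hom : (T T′ : DTObj W) (ψ : NatFam (Carrier T) (Carrier T′)) → IsDTHom (ops T) (ops T′) ψ →
                ∀ {A : Set} (x : Carrier T A) → hcomp (Carrier T) (Carrier T′) (λ B → B) (λ B → B) (mp T) ψ (λ y → y) x ≡ ψ x
    assoc-hom : (T₁ T₁′ T₂ T₂′ T₃ T₃′ : DTObj W)
                (ψ₁ : NatFam (Carrier T₁) (Carrier T₁′)) (ψ₂ : NatFam (Carrier T₂) (Carrier T₂′))
                (ψ₃ : NatFam (Carrier T₃) (Carrier T₃′)) →
                IsDTHom (ops T₁) (ops T₁′) ψ₁ → IsDTHom (ops T₂) (ops T₂′) ψ₂ → IsDTHom (ops T₃) (ops T₃′) ψ₃ →
                ∀ {A : Set} (x : Carrier T₁ (Carrier T₂ (Carrier T₃ A))) →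
                hcomp (λ B → Carrier T₁ (Carrier T₂ B)) (λ B → Carrier T₁′ (Carrier T₂′ B)) (Carrier T₃) (Carrier T₃′)
                      (DecTravOps.map (ops T₁ ⊗ ops T₂))
                      (hcomp (Carrier T₁) (Carrier T₁′) (Carrier T₂) (Carrier T₂′) (mp T₁) ψ₁ ψ₂) ψ₃ x
                  ≡ hcomp (Carrier T₁) (Carrier T₁′) (λ B → Carrier T₂ (Carrier T₃ B)) (λ B → Carrier T₂′ (Carrier T₃′ B)) (mp T₁) ψ₁
                    (hcomp (Carrier T₂) (Carrier T₂′) (Carrier T₃) (Carrier T₃′) (mp T₂) ψ₂ ψ₃) x

-- By naturality of dec_{T₁}, the composite decoration has the closed form
--   dec_{T₁∘T₂} = map_{T₁} redecorate ∘ dec_{T₁},   redecorate (w , u) = map_{T₂} (prepend w) (dec_{T₂} u),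
-- i.e. an inner weight v becomes w · v.  Every law of the composite then reduces, after fusing
-- maps, to the corresponding law of T₁ plus a pointwise identity for redecorate; no monoid law is
-- used there.  The unit and associativity of W enter only in the strictness of the unit and of
-- the associator, through prepend ε = id and prepend (w · v) = prepend w ∘ prepend v.
module Submission where

open import Defs
open import Level using (0ℓ)
open import Relation.Binary.PropositionalEquality using (_≡_; refl; sym; trans; cong; module ≡-Reasoning)
open import Algebra.Structures using (IsMonoid)
open import Algebra.Definitions using (LeftIdentity; RightIdentity; Associative)
open import Axiom.Extensionality.Propositional using (Extensionality)
open import Data.Product using (_×_; _,_; map₂)
open import Function using (_∘_; id)

module ApplicativeProperties (Ap : RawApplicative) (isAp : IsApplicative Ap) where
  open RawApplicative Ap
  open IsApplicative isAp
  open ≡-Reasoning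

  map-id : ∀ {A : Set} (x : F A) → map id x ≡ x
  map-id x = trans (map-pure id x) (identity x)

  map-∘ : ∀ {A B C : Set} (g : B → C) (f : A → B) (x : F A) → map (g ∘ f) x ≡ map g (map f x)
  map-∘ g f x = begin
    map (g ∘ f) x                                   ≡⟨ map-pure (g ∘ f) x ⟩
    pure (g ∘ f) ⊛ x                                ≡⟨ cong (_⊛ x) (homomorphism (g ∘_) f) ⟨
    pure (g ∘_) ⊛ pure f ⊛ x                        ≡⟨ cong (λ h → h ⊛ pure f ⊛ x) (homomorphism (λ g′ f′ → g′ ∘ f′) g) ⟨
    pure (λ g′ f′ → g′ ∘ f′) ⊛ pure g ⊛ pure f ⊛ x  ≡⟨ composition (pure g) (pure f) x ⟨
    pure g ⊛ (pure f ⊛ x)                           ≡⟨ cong (pure g ⊛_) (map-pure f x) ⟨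
    pure g ⊛ map f x                                ≡⟨ map-pure g (map f x) ⟨
    map g (map f x)                                 ∎

id-isDTHom : ∀ {W : Set} {T : Set → Set} (S : DecTravOps W T) → IsDTHom S S id
id-isDTHom S = record
  { natural  = λ f x → refl
  ; hom-dec  = λ x → refl
  ; hom-dist = λ Ap isAp x → sym (ApplicativeProperties.map-id Ap isAp _)
  }

∘-isDTHom : ∀ {W : Set} {T₁ T₂ T₃ : Set → Set}
              {S₁ : DecTravOps W T₁} {S₂ : DecTravOps W T₂} {S₃ : DecTravOps W T₃}
              {ψ : NatFam T₂ T₃} {φ : NatFam T₁ T₂} →
              IsDTHom S₂ S₃ ψ → IsDTHom S₁ S₂ φ → IsDTHom S₁ S₃ (λ x → ψ (φ x))
∘-isDTHom {ψ = ψ} {φ} hψ hφ = record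
  { natural  = λ f x → trans (cong ψ (Hφ.natural f x)) (Hψ.natural f (φ x))
  ; hom-dec  = λ x → trans (cong ψ (Hφ.hom-dec x)) (Hψ.hom-dec (φ x))
  ; hom-dist = λ Ap isAp x →
      trans (Hψ.hom-dist Ap isAp (φ x))
            (trans (cong (RawApplicative.map Ap ψ) (Hφ.hom-dist Ap isAp x))
                   (sym (ApplicativeProperties.map-∘ Ap isAp ψ φ _)))
  }
  where
  module Hψ = IsDTHom hψ
  module Hφ = IsDTHom hφ

prepend : ∀ {W A : Set} → (W → W → W) → W → W × A → W × A
prepend _·_ w p = join _·_ (w , p)

module _ (ext : Extensionality 0ℓ 0ℓ) {W : Set} where

  module DecTravProperties {T : Set → Set} (S : DecTravOps W T) (L : IsDecTrav S) where
    open DecTravOps S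
    open IsDecTrav L

    map-cong : ∀ {A B : Set} {f g : A → B} → (∀ a → f a ≡ g a) → (x : T A) → map f x ≡ map g x
    map-cong f≗g x = cong (λ h → map h x) (ext f≗g)

    map-dec-map : ∀ {A B C : Set} (g : W × B → C) (f : A → B) (x : T A) →
                  map g (dec (map f x)) ≡ map (g ∘ map₂ f) (dec x)
    map-dec-map g f x = trans (cong (map g) (sym (dec-natural f x))) (sym (map-∘ g (map₂ f) (dec x)))

  unit-isDecTrav : (ε : W) → IsDecTrav (unitOps ε)
  unit-isDecTrav ε = record
    { map-id        = λ x → refl
    ; map-∘         = λ g f x → refl
    ; dec-natural   = λ f x → refl
    ; dec-extr      = λ x → refl
    ; dec-dup       = λ x → refl
    ; dist-natural  = λ Ap isAp f x → refl
    ; dist-id       = λ isAp x → refl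
    ; dist-∘        = λ Fa Ga pF pG pFG x → sym (ApplicativeProperties.map-id Fa pF x)
    ; dist-morphism = λ Fa Ga pF pG φ isφ x → refl
    ; dec-dist      = λ Ap isAp x → refl
    }

  module Tensor (_·_ : W → W → W) {T₁ T₂ : Set → Set}
                (S₁ : DecTravOps W T₁) (L₁ : IsDecTrav S₁)
                (S₂ : DecTravOps W T₂) (L₂ : IsDecTrav S₂) where
    private
      module S₁ = DecTravOps S₁
      module S₂ = DecTravOps S₂
      module L₁ = IsDecTrav L₁
      module L₂ = IsDecTrav L₂
      module P₁ = DecTravProperties S₁ L₁
      module P₂ = DecTravProperties S₂ L₂
      module S = DecTravOps (tensorOps _·_ S₁ S₂)
    open ≡-Reasoning

    redecorate : ∀ {A : Set} → W × T₂ A → T₂ (W × A)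
    redecorate (w , u) = S₂.map (prepend _·_ w) (S₂.dec u)

    dec-≡-map-redecorate : ∀ {A : Set} (x : T₁ (T₂ A)) → S.dec x ≡ S₁.map redecorate (S₁.dec x)
    dec-≡-map-redecorate x =
      trans (P₁.map-dec-map _ S₂.dec x)
            (P₁.map-cong (λ (w , u) → sym (L₂.map-∘ (join _·_) (w ,_) (S₂.dec u))) (S₁.dec x))

    map-dec : ∀ {A B : Set} (g : T₂ (W × A) → B) (x : T₁ (T₂ A)) →
              S₁.map g (S.dec x) ≡ S₁.map (g ∘ redecorate) (S₁.dec x)
    map-dec g x = trans (cong (S₁.map g) (dec-≡-map-redecorate x)) (sym (L₁.map-∘ g redecorate (S₁.dec x)))

    redecorate-natural : ∀ {A B : Set} (f : A → B) (q : W × T₂ A) →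
                         S₂.map (map₂ f) (redecorate q) ≡ redecorate (map₂ (S₂.map f) q)
    redecorate-natural f (w , u) = begin
      S₂.map (map₂ f) (S₂.map (prepend _·_ w) (S₂.dec u))  ≡⟨ L₂.map-∘ _ _ _ ⟨
      S₂.map (prepend _·_ w ∘ map₂ f) (S₂.dec u)           ≡⟨ L₂.map-∘ _ _ _ ⟩
      S₂.map (prepend _·_ w) (S₂.map (map₂ f) (S₂.dec u))  ≡⟨ cong (S₂.map _) (L₂.dec-natural f u) ⟩
      S₂.map (prepend _·_ w) (S₂.dec (S₂.map f u))         ∎

    redecorate-extr : ∀ {A : Set} (q : W × T₂ A) → S₂.map extr (redecorate q) ≡ extr q
    redecorate-extr (w , u) = trans (sym (L₂.map-∘ extr (prepend _·_ w) (S₂.dec u))) (L₂.dec-extr u)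

    redecorate-dup : ∀ {A : Set} (q : W × T₂ A) →
                     S₂.map dup (redecorate q) ≡ redecorate (map₂ redecorate (dup q))
    redecorate-dup (w , u) = begin
      S₂.map dup (S₂.map (prepend _·_ w) (S₂.dec u))            ≡⟨ L₂.map-∘ _ _ _ ⟨
      S₂.map (prepend _·_ w ∘ map₂ (prepend _·_ w) ∘ dup) (S₂.dec u)
        ≡⟨ trans (L₂.map-∘ _ _ _) (cong (S₂.map _) (L₂.map-∘ _ _ _)) ⟩
      S₂.map (prepend _·_ w) (S₂.map (map₂ (prepend _·_ w)) (S₂.map dup (S₂.dec u)))
        ≡⟨ cong (λ v → S₂.map (prepend _·_ w) (S₂.map (map₂ (prepend _·_ w)) v)) (L₂.dec-dup u) ⟩
      S₂.map (prepend _·_ w) (S₂.map (map₂ (prepend _·_ w)) (S₂.dec (S₂.dec u)))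
        ≡⟨ cong (S₂.map _) (L₂.dec-natural _ _) ⟩
      S₂.map (prepend _·_ w) (S₂.dec (S₂.map (prepend _·_ w) (S₂.dec u))) ∎

    module _ (Ap : RawApplicative) (isAp : IsApplicative Ap) where
      private
        open RawApplicative Ap using () renaming (map to mapF)
        module PF = ApplicativeProperties Ap isAp

      redecorate-dist : ∀ {A : Set} (q : W × T₂ (RawApplicative.F Ap A)) →
                        mapF redecorate (σ mapF (map₂ (S₂.dist Ap isAp) q))
                          ≡ S₂.dist Ap isAp (S₂.map (σ mapF) (redecorate q))
      redecorate-dist (w , u) = begin
        mapF redecorate (mapF (w ,_) (dist₂ u))              ≡⟨ PF.map-∘ _ _ _ ⟨
        mapF (S₂.map (prepend _·_ w) ∘ S₂.dec) (dist₂ u)     ≡⟨ PF.map-∘ _ _ _ ⟩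
        mapF (S₂.map (prepend _·_ w)) (mapF S₂.dec (dist₂ u)) ≡⟨ cong (mapF _) (L₂.dec-dist Ap isAp u) ⟩
        mapF (S₂.map (prepend _·_ w)) (dist₂ (S₂.map (σ mapF) (S₂.dec u)))
          ≡⟨ L₂.dist-natural Ap isAp _ _ ⟩
        dist₂ (S₂.map (mapF (prepend _·_ w)) (S₂.map (σ mapF) (S₂.dec u)))
          ≡⟨ cong dist₂ (sym (L₂.map-∘ _ _ _)) ⟩
        dist₂ (S₂.map (mapF (prepend _·_ w) ∘ σ mapF) (S₂.dec u))
          ≡⟨ cong dist₂ (P₂.map-cong (λ (v , y) → sym (PF.map-∘ _ (v ,_) y)) (S₂.dec u)) ⟩
        dist₂ (S₂.map (σ mapF ∘ prepend _·_ w) (S₂.dec u))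
          ≡⟨ cong dist₂ (L₂.map-∘ _ _ _) ⟩
        dist₂ (S₂.map (σ mapF) (S₂.map (prepend _·_ w) (S₂.dec u))) ∎
        where dist₂ = S₂.dist Ap isAp

    dec-natural : ∀ {A B : Set} (f : A → B) (x : T₁ (T₂ A)) → S.map (map₂ f) (S.dec x) ≡ S.dec (S.map f x)
    dec-natural f x = begin
      S₁.map (S₂.map (map₂ f)) (S.dec x)                         ≡⟨ map-dec _ x ⟩
      S₁.map (S₂.map (map₂ f) ∘ redecorate) (S₁.dec x)           ≡⟨ P₁.map-cong (redecorate-natural f) _ ⟩
      S₁.map (redecorate ∘ map₂ (S₂.map f)) (S₁.dec x)           ≡⟨ P₁.map-dec-map _ _ x ⟨
      S₁.map redecorate (S₁.dec (S₁.map (S₂.map f) x))           ≡⟨ dec-≡-map-redecorate _ ⟨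
      S.dec (S.map f x)                                          ∎

    dec-extr : ∀ {A : Set} (x : T₁ (T₂ A)) → S.map extr (S.dec x) ≡ x
    dec-extr x = begin
      S₁.map (S₂.map extr) (S.dec x)                ≡⟨ map-dec _ x ⟩
      S₁.map (S₂.map extr ∘ redecorate) (S₁.dec x)  ≡⟨ P₁.map-cong redecorate-extr _ ⟩
      S₁.map extr (S₁.dec x)                        ≡⟨ L₁.dec-extr x ⟩
      x                                             ∎

    dec-dup : ∀ {A : Set} (x : T₁ (T₂ A)) → S.map dup (S.dec x) ≡ S.dec (S.dec x)
    dec-dup x = begin
      S₁.map (S₂.map dup) (S.dec x)                                    ≡⟨ map-dec _ x ⟩
      S₁.map (S₂.map dup ∘ redecorate) (S₁.dec x)                      ≡⟨ P₁.map-cong redecorate-dup _ ⟩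
      S₁.map (redecorate ∘ map₂ redecorate ∘ dup) (S₁.dec x)
        ≡⟨ trans (L₁.map-∘ _ _ _) (cong (S₁.map redecorate) (L₁.map-∘ _ _ _)) ⟩
      S₁.map redecorate (S₁.map (map₂ redecorate) (S₁.map dup (S₁.dec x)))
        ≡⟨ cong (λ y → S₁.map redecorate (S₁.map (map₂ redecorate) y)) (L₁.dec-dup x) ⟩
      S₁.map redecorate (S₁.map (map₂ redecorate) (S₁.dec (S₁.dec x)))
        ≡⟨ cong (S₁.map redecorate) (L₁.dec-natural redecorate (S₁.dec x)) ⟩
      S₁.map redecorate (S₁.dec (S₁.map redecorate (S₁.dec x)))
        ≡⟨ trans (dec-≡-map-redecorate _) (cong (S₁.map redecorate ∘ S₁.dec) (dec-≡-map-redecorate x)) ⟨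
      S.dec (S.dec x)                                                  ∎

    dec-dist : (Ap : RawApplicative) (isAp : IsApplicative Ap) →
               ∀ {A : Set} (x : T₁ (T₂ (RawApplicative.F Ap A))) →
               RawApplicative.map Ap S.dec (S.dist Ap isAp x)
                 ≡ S.dist Ap isAp (S.map (σ (RawApplicative.map Ap)) (S.dec x))
    dec-dist Ap isAp x = begin
      mapF S.dec (dist₁ (S₁.map dist₂ x))
        ≡⟨ cong (λ h → mapF h (dist₁ (S₁.map dist₂ x))) (ext dec-≡-map-redecorate) ⟩
      mapF (S₁.map redecorate ∘ S₁.dec) (dist₁ (S₁.map dist₂ x))
        ≡⟨ PF.map-∘ _ _ _ ⟩
      mapF (S₁.map redecorate) (mapF S₁.dec (dist₁ (S₁.map dist₂ x)))
        ≡⟨ cong (mapF _) (L₁.dec-dist Ap isAp _) ⟩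
      mapF (S₁.map redecorate) (dist₁ (S₁.map (σ mapF) (S₁.dec (S₁.map dist₂ x))))
        ≡⟨ L₁.dist-natural Ap isAp _ _ ⟩
      dist₁ (S₁.map (mapF redecorate) (S₁.map (σ mapF) (S₁.dec (S₁.map dist₂ x))))
        ≡⟨ cong dist₁ (trans (sym (L₁.map-∘ _ _ _)) (P₁.map-dec-map _ dist₂ x)) ⟩
      dist₁ (S₁.map (mapF redecorate ∘ σ mapF ∘ map₂ dist₂) (S₁.dec x))
        ≡⟨ cong dist₁ (P₁.map-cong (redecorate-dist Ap isAp) _) ⟩
      dist₁ (S₁.map (dist₂ ∘ S₂.map (σ mapF) ∘ redecorate) (S₁.dec x))
        ≡⟨ cong dist₁ (trans (L₁.map-∘ _ _ _) (cong (S₁.map dist₂) (L₁.map-∘ _ _ _))) ⟩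
      dist₁ (S₁.map dist₂ (S₁.map (S₂.map (σ mapF)) (S₁.map redecorate (S₁.dec x))))
        ≡⟨ cong (λ y → dist₁ (S₁.map dist₂ (S₁.map (S₂.map (σ mapF)) y))) (dec-≡-map-redecorate x) ⟨
      dist₁ (S₁.map dist₂ (S₁.map (S₂.map (σ mapF)) (S.dec x))) ∎
      where
      mapF = RawApplicative.map Ap
      dist₁ = S₁.dist Ap isAp
      dist₂ = S₂.dist Ap isAp
      module PF = ApplicativeProperties Ap isAp

    dist-natural : (Ap : RawApplicative) (isAp : IsApplicative Ap) →
                   ∀ {A B : Set} (f : A → B) (x : T₁ (T₂ (RawApplicative.F Ap A))) →
                   RawApplicative.map Ap (S.map f) (S.dist Ap isAp x)
                     ≡ S.dist Ap isAp (S.map (RawApplicative.map Ap f) x)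
    dist-natural Ap isAp f x = begin
      mapF (S₁.map (S₂.map f)) (dist₁ (S₁.map dist₂ x))   ≡⟨ L₁.dist-natural Ap isAp _ _ ⟩
      dist₁ (S₁.map (mapF (S₂.map f)) (S₁.map dist₂ x))   ≡⟨ cong dist₁ (L₁.map-∘ _ _ _) ⟨
      dist₁ (S₁.map (mapF (S₂.map f) ∘ dist₂) x)          ≡⟨ cong dist₁ (P₁.map-cong (L₂.dist-natural Ap isAp f) x) ⟩
      dist₁ (S₁.map (dist₂ ∘ S₂.map (mapF f)) x)          ≡⟨ cong dist₁ (L₁.map-∘ _ _ _) ⟩
      dist₁ (S₁.map dist₂ (S₁.map (S₂.map (mapF f)) x))   ∎
      where
      mapF = RawApplicative.map Ap
      dist₁ = S₁.dist Ap isAp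
      dist₂ = S₂.dist Ap isAp

    dist-id : (isAp : IsApplicative idApp) → ∀ {A : Set} (x : T₁ (T₂ A)) → S.dist idApp isAp x ≡ x
    dist-id isAp x = begin
      S₁.dist idApp isAp (S₁.map (S₂.dist idApp isAp) x)  ≡⟨ cong (S₁.dist idApp isAp) (P₁.map-cong (L₂.dist-id isAp) x) ⟩
      S₁.dist idApp isAp (S₁.map id x)                    ≡⟨ cong (S₁.dist idApp isAp) (L₁.map-id x) ⟩
      S₁.dist idApp isAp x                                ≡⟨ L₁.dist-id isAp x ⟩
      x                                                   ∎

    dist-∘ : (Fa Ga : RawApplicative) (pF : IsApplicative Fa) (pG : IsApplicative Ga)
             (pFG : IsApplicative (Fa ∘App Ga)) →
             ∀ {A : Set} (x : T₁ (T₂ (RawApplicative.F Fa (RawApplicative.F Ga A)))) →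
             S.dist (Fa ∘App Ga) pFG x ≡ RawApplicative.map Fa (S.dist Ga pG) (S.dist Fa pF x)
    dist-∘ Fa Ga pF pG pFG x = begin
      S₁.dist FG pFG (S₁.map (S₂.dist FG pFG) x)
        ≡⟨ cong (S₁.dist FG pFG) (P₁.map-cong (L₂.dist-∘ Fa Ga pF pG pFG) x) ⟩
      S₁.dist FG pFG (S₁.map (mapF (S₂.dist Ga pG) ∘ S₂.dist Fa pF) x)
        ≡⟨ L₁.dist-∘ Fa Ga pF pG pFG _ ⟩
      mapF (S₁.dist Ga pG) (S₁.dist Fa pF (S₁.map (mapF (S₂.dist Ga pG) ∘ S₂.dist Fa pF) x))
        ≡⟨ cong (mapF (S₁.dist Ga pG) ∘ S₁.dist Fa pF) (L₁.map-∘ _ _ _) ⟩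
      mapF (S₁.dist Ga pG) (S₁.dist Fa pF (S₁.map (mapF (S₂.dist Ga pG)) (S₁.map (S₂.dist Fa pF) x)))
        ≡⟨ cong (mapF (S₁.dist Ga pG)) (L₁.dist-natural Fa pF _ _) ⟨
      mapF (S₁.dist Ga pG) (mapF (S₁.map (S₂.dist Ga pG)) (S₁.dist Fa pF (S₁.map (S₂.dist Fa pF) x)))
        ≡⟨ ApplicativeProperties.map-∘ Fa pF _ _ _ ⟨
      mapF (S₁.dist Ga pG ∘ S₁.map (S₂.dist Ga pG)) (S₁.dist Fa pF (S₁.map (S₂.dist Fa pF) x)) ∎
      where
      FG = Fa ∘App Ga
      mapF = RawApplicative.map Fa

    dist-morphism : (Fa Ga : RawApplicative) (pF : IsApplicative Fa) (pG : IsApplicative Ga)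
                    (φ : ∀ {A : Set} → RawApplicative.F Fa A → RawApplicative.F Ga A) →
                    IsApplicativeMorphism Fa Ga φ →
                    ∀ {A : Set} (x : T₁ (T₂ (RawApplicative.F Fa A))) →
                    φ (S.dist Fa pF x) ≡ S.dist Ga pG (S.map φ x)
    dist-morphism Fa Ga pF pG φ isφ x = begin
      φ (S₁.dist Fa pF (S₁.map (S₂.dist Fa pF) x))       ≡⟨ L₁.dist-morphism Fa Ga pF pG φ isφ _ ⟩
      S₁.dist Ga pG (S₁.map φ (S₁.map (S₂.dist Fa pF) x)) ≡⟨ cong (S₁.dist Ga pG) (L₁.map-∘ _ _ _) ⟨
      S₁.dist Ga pG (S₁.map (φ ∘ S₂.dist Fa pF) x)
        ≡⟨ cong (S₁.dist Ga pG) (P₁.map-cong (L₂.dist-morphism Fa Ga pF pG φ isφ) x) ⟩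
      S₁.dist Ga pG (S₁.map (S₂.dist Ga pG ∘ S₂.map φ) x) ≡⟨ cong (S₁.dist Ga pG) (L₁.map-∘ _ _ _) ⟩
      S₁.dist Ga pG (S₁.map (S₂.dist Ga pG) (S₁.map (S₂.map φ) x)) ∎

    isDecTrav : IsDecTrav (tensorOps _·_ S₁ S₂)
    isDecTrav = record
      { map-id        = λ x → trans (P₁.map-cong L₂.map-id x) (L₁.map-id x)
      ; map-∘         = λ g f x → trans (P₁.map-cong (L₂.map-∘ g f) x) (L₁.map-∘ _ _ x)
      ; dec-natural   = dec-natural
      ; dec-extr      = dec-extr
      ; dec-dup       = dec-dup
      ; dist-natural  = dist-natural
      ; dist-id       = dist-id
      ; dist-∘        = dist-∘
      ; dist-morphism = dist-morphism
      ; dec-dist      = dec-dist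
      }

  module TensorHom (_·_ : W → W → W) {T₁ T₁′ T₂ T₂′ : Set → Set}
                   {S₁ : DecTravOps W T₁} (L₁ : IsDecTrav S₁) {S₁′ : DecTravOps W T₁′} (L₁′ : IsDecTrav S₁′)
                   {S₂ : DecTravOps W T₂} (L₂ : IsDecTrav S₂) {S₂′ : DecTravOps W T₂′} (L₂′ : IsDecTrav S₂′)
                   {ψ : NatFam T₁ T₁′} {φ : NatFam T₂ T₂′} (hψ : IsDTHom S₁ S₁′ ψ) (hφ : IsDTHom S₂ S₂′ φ) where
    private
      module S₁ = DecTravOps S₁
      module S₂ = DecTravOps S₂
      module S₁′ = DecTravOps S₁′
      module S₂′ = DecTravOps S₂′
      module L₁ = IsDecTrav L₁
      module P₁ = DecTravProperties S₁ L₁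
      module Hψ = IsDTHom hψ
      module Hφ = IsDTHom hφ
      module ⊗ = Tensor _·_ S₁ L₁ S₂ L₂
      module ⊗′ = Tensor _·_ S₁′ L₁′ S₂′ L₂′
      module S = DecTravOps (tensorOps _·_ S₁ S₂)
      module S′ = DecTravOps (tensorOps _·_ S₁′ S₂′)
    open ≡-Reasoning

    ψ⋆φ : NatFam (λ A → T₁ (T₂ A)) (λ A → T₁′ (T₂′ A))
    ψ⋆φ = hcomp T₁ T₁′ T₂ T₂′ S₁.map ψ φ

    map-through-φ : ∀ {A B : Set} {g : T₂ A → B} {f′ : T₂′ A → B} → (∀ u → g u ≡ f′ (φ u)) →
                    (x : T₁ (T₂ A)) → ψ (S₁.map g x) ≡ S₁′.map f′ (ψ⋆φ x)
    map-through-φ {g = g} {f′} g≗f′φ x = begin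
      ψ (S₁.map g x)               ≡⟨ cong ψ (P₁.map-cong g≗f′φ x) ⟩
      ψ (S₁.map (f′ ∘ φ) x)        ≡⟨ cong ψ (L₁.map-∘ _ _ _) ⟩
      ψ (S₁.map f′ (S₁.map φ x))   ≡⟨ Hψ.natural _ _ ⟩
      S₁′.map f′ (ψ⋆φ x)           ∎

    redecorate-hom : ∀ {A : Set} (q : W × T₂ A) → φ (⊗.redecorate q) ≡ ⊗′.redecorate (map₂ φ q)
    redecorate-hom (w , u) = trans (Hφ.natural _ _) (cong (S₂′.map (prepend _·_ w)) (Hφ.hom-dec u))

    hom-dec : ∀ {A : Set} (x : T₁ (T₂ A)) → ψ⋆φ (S.dec x) ≡ S′.dec (ψ⋆φ x)
    hom-dec x = begin
      ψ (S₁.map φ (S.dec x))                            ≡⟨ cong ψ (⊗.map-dec φ x) ⟩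
      ψ (S₁.map (φ ∘ ⊗.redecorate) (S₁.dec x))          ≡⟨ cong ψ (P₁.map-cong redecorate-hom _) ⟩
      ψ (S₁.map (⊗′.redecorate ∘ map₂ φ) (S₁.dec x))    ≡⟨ cong ψ (P₁.map-dec-map _ φ x) ⟨
      ψ (S₁.map ⊗′.redecorate (S₁.dec (S₁.map φ x)))    ≡⟨ Hψ.natural _ _ ⟩
      S₁′.map ⊗′.redecorate (ψ (S₁.dec (S₁.map φ x)))   ≡⟨ cong (S₁′.map ⊗′.redecorate) (Hψ.hom-dec _) ⟩
      S₁′.map ⊗′.redecorate (S₁′.dec (ψ⋆φ x))           ≡⟨ ⊗′.dec-≡-map-redecorate _ ⟨
      S′.dec (ψ⋆φ x)                                    ∎

    hom-dist : (Ap : RawApplicative) (isAp : IsApplicative Ap) →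
               ∀ {A : Set} (x : T₁ (T₂ (RawApplicative.F Ap A))) →
               S′.dist Ap isAp (ψ⋆φ x) ≡ RawApplicative.map Ap ψ⋆φ (S.dist Ap isAp x)
    hom-dist Ap isAp x = begin
      S₁′.dist Ap isAp (S₁′.map (S₂′.dist Ap isAp) (ψ⋆φ x))
        ≡⟨ cong (S₁′.dist Ap isAp) (map-through-φ (λ u → sym (Hφ.hom-dist Ap isAp u)) x) ⟨
      S₁′.dist Ap isAp (ψ (S₁.map (mapF φ ∘ S₂.dist Ap isAp) x))
        ≡⟨ Hψ.hom-dist Ap isAp _ ⟩
      mapF ψ (S₁.dist Ap isAp (S₁.map (mapF φ ∘ S₂.dist Ap isAp) x))
        ≡⟨ cong (mapF ψ ∘ S₁.dist Ap isAp) (L₁.map-∘ _ _ _) ⟩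
      mapF ψ (S₁.dist Ap isAp (S₁.map (mapF φ) (S₁.map (S₂.dist Ap isAp) x)))
        ≡⟨ cong (mapF ψ) (L₁.dist-natural Ap isAp φ _) ⟨
      mapF ψ (mapF (S₁.map φ) (S₁.dist Ap isAp (S₁.map (S₂.dist Ap isAp) x)))
        ≡⟨ ApplicativeProperties.map-∘ Ap isAp _ _ _ ⟨
      mapF ψ⋆φ (S₁.dist Ap isAp (S₁.map (S₂.dist Ap isAp) x)) ∎
      where mapF = RawApplicative.map Ap

    isDTHom : IsDTHom (tensorOps _·_ S₁ S₂) (tensorOps _·_ S₁′ S₂′) ψ⋆φ
    isDTHom = record
      { natural  = λ f x → trans (cong ψ (sym (L₁.map-∘ φ (S₂.map f) x))) (map-through-φ (Hφ.natural f) x)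
      ; hom-dec  = hom-dec
      ; hom-dist = hom-dist
      }

  module _ {_·_ : W → W → W} {ε : W} {T : Set → Set} {S : DecTravOps W T} (L : IsDecTrav S) where
    private
      module S = DecTravOps S
      module L = IsDecTrav L
      module P = DecTravProperties S L

    map-prepend-identity : LeftIdentity _≡_ ε _·_ → ∀ {A : Set} (y : T (W × A)) → S.map (prepend _·_ ε) y ≡ y
    map-prepend-identity identityˡ y = trans (P.map-cong (λ (v , a) → cong (_, a) (identityˡ v)) y) (L.map-id y)

    ⊗-unitˡ : LeftIdentity _≡_ ε _·_ → tensorOps _·_ (unitOps ε) S ≈Ops S
    ⊗-unitˡ identityˡ = record
      { map-≈  = λ f x → refl
      ; dec-≈  = λ x → trans (sym (L.map-∘ (join _·_) (ε ,_) (S.dec x))) (map-prepend-identity identityˡ (S.dec x))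
      ; dist-≈ = λ Ap isAp x → refl
      }

    ⊗-unitʳ : RightIdentity _≡_ ε _·_ → tensorOps _·_ S (unitOps ε) ≈Ops S
    ⊗-unitʳ identityʳ = record
      { map-≈  = λ f x → refl
      ; dec-≈  = λ x → trans (Tensor.dec-≡-map-redecorate _·_ S L (unitOps ε) (unit-isDecTrav ε) x)
                             (trans (P.map-cong (λ (w , a) → cong (_, a) (identityʳ w)) (S.dec x)) (L.map-id (S.dec x)))
      ; dist-≈ = λ Ap isAp x → cong (S.dist Ap isAp) (L.map-id x)
      }

  module _ {_·_ : W → W → W} (assoc : Associative _≡_ _·_) {T₁ T₂ T₃ : Set → Set}
           {S₁ : DecTravOps W T₁} (L₁ : IsDecTrav S₁) {S₂ : DecTravOps W T₂} (L₂ : IsDecTrav S₂)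
           {S₃ : DecTravOps W T₃} (L₃ : IsDecTrav S₃) where
    private
      module S₁ = DecTravOps S₁
      module S₂ = DecTravOps S₂
      module S₃ = DecTravOps S₃
      module L₁ = IsDecTrav L₁
      module L₂ = IsDecTrav L₂
      module L₃ = IsDecTrav L₃
      module P₁ = DecTravProperties S₁ L₁
      module P₂ = DecTravProperties S₂ L₂
      module P₃ = DecTravProperties S₃ L₃
      module T₁₂ = Tensor _·_ S₁ L₁ S₂ L₂
      module T₂₃ = Tensor _·_ S₂ L₂ S₃ L₃
      module T₁₂,₃ = Tensor _·_ (tensorOps _·_ S₁ S₂) T₁₂.isDecTrav S₃ L₃
      module T₁,₂₃ = Tensor _·_ S₁ L₁ (tensorOps _·_ S₂ S₃) T₂₃.isDecTrav
    open ≡-Reasoning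

    map-prepend-· : ∀ {A : Set} (w v : W) (y : T₃ (W × A)) →
                    S₃.map (prepend _·_ (w · v)) y ≡ S₃.map (prepend _·_ w) (S₃.map (prepend _·_ v) y)
    map-prepend-· w v y = trans (P₃.map-cong (λ (t , a) → cong (_, a) (assoc w v t)) y) (L₃.map-∘ _ _ y)

    redecorate-assoc : ∀ {A : Set} (q : W × T₂ (T₃ A)) →
                       S₂.map T₂₃.redecorate (T₁₂.redecorate q) ≡ T₁,₂₃.redecorate q
    redecorate-assoc (w , u) = begin
      S₂.map T₂₃.redecorate (S₂.map (prepend _·_ w) (S₂.dec u))  ≡⟨ L₂.map-∘ _ _ _ ⟨
      S₂.map (T₂₃.redecorate ∘ prepend _·_ w) (S₂.dec u)         ≡⟨ P₂.map-cong (λ (v , y) → map-prepend-· w v (S₃.dec y)) _ ⟩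
      S₂.map (S₃.map (prepend _·_ w) ∘ T₂₃.redecorate) (S₂.dec u) ≡⟨ L₂.map-∘ _ _ _ ⟩
      S₂.map (S₃.map (prepend _·_ w)) (S₂.map T₂₃.redecorate (S₂.dec u))
        ≡⟨ cong (S₂.map (S₃.map (prepend _·_ w))) (T₂₃.dec-≡-map-redecorate u) ⟨
      S₂.map (S₃.map (prepend _·_ w)) (DecTravOps.dec (tensorOps _·_ S₂ S₃) u) ∎

    ⊗-assoc : tensorOps _·_ (tensorOps _·_ S₁ S₂) S₃ ≈Ops tensorOps _·_ S₁ (tensorOps _·_ S₂ S₃)
    ⊗-assoc = record
      { map-≈  = λ f x → refl
      ; dec-≈  = λ x → begin
          DecTravOps.dec (tensorOps _·_ (tensorOps _·_ S₁ S₂) S₃) x   ≡⟨ T₁₂,₃.dec-≡-map-redecorate x ⟩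
          S₁.map (S₂.map T₂₃.redecorate) (DecTravOps.dec (tensorOps _·_ S₁ S₂) x) ≡⟨ T₁₂.map-dec _ x ⟩
          S₁.map (S₂.map T₂₃.redecorate ∘ T₁₂.redecorate) (S₁.dec x) ≡⟨ P₁.map-cong redecorate-assoc _ ⟩
          S₁.map T₁,₂₃.redecorate (S₁.dec x)                          ≡⟨ T₁,₂₃.dec-≡-map-redecorate x ⟨
          DecTravOps.dec (tensorOps _·_ S₁ (tensorOps _·_ S₂ S₃)) x   ∎
      ; dist-≈ = λ Ap isAp x → cong (S₁.dist Ap isAp) (sym (L₁.map-∘ _ _ x))
      }

lemma21 : Extensionality 0ℓ 0ℓ →
          {W : Set} (_·_ : W → W → W) (ε : W) → IsMonoid _≡_ _·_ ε →
          DecTravStrictMonoidal _·_ ε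
lemma21 ext _·_ ε isMonoid = record
  { unit-isDecTrav = unit-isDecTrav ext ε
  ; ⊗-isDecTrav    = λ T₁ T₂ → Tensor.isDecTrav ext _·_ (ops T₁) (isDT T₁) (ops T₂) (isDT T₂)
  ; id-isHom       = λ T → id-isDTHom (ops T)
  ; ∘-isHom        = λ _ _ _ _ _ → ∘-isDTHom
  ; idˡ            = λ _ _ _ _ _ → refl
  ; idʳ            = λ _ _ _ _ _ → refl
  ; assoc          = λ _ _ _ _ _ _ _ _ _ _ _ → refl
  ; ⊗-isHom        = λ T₁ T₁′ T₂ T₂′ _ _ →
                       TensorHom.isDTHom ext _·_ (isDT T₁) (isDT T₁′) (isDT T₂) (isDT T₂′)
  ; ⊗-id           = λ T₁ _ → IsDecTrav.map-id (isDT T₁)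
  ; ⊗-∘            = λ T₁ _ _ _ _ _ ψ ψ′ φ φ′ hψ _ _ _ x →
                       cong ψ′ (trans (cong ψ (IsDecTrav.map-∘ (isDT T₁) φ′ φ x)) (IsDTHom.natural hψ φ′ _))
  ; unitˡ-obj      = λ T → ⊗-unitˡ ext (isDT T) identityˡ
  ; unitʳ-obj      = λ T → ⊗-unitʳ ext (isDT T) identityʳ
  ; assoc-obj      = λ T₁ T₂ T₃ → ⊗-assoc ext assoc (isDT T₁) (isDT T₂) (isDT T₃)
  ; unitˡ-hom      = λ _ _ _ _ _ → refl
  ; unitʳ-hom      = λ T _ ψ _ x → cong ψ (IsDecTrav.map-id (isDT T) x)
  ; assoc-hom      = λ T₁ _ _ _ _ _ ψ₁ ψ₂ ψ₃ _ _ _ x → cong ψ₁ (sym (IsDecTrav.map-∘ (isDT T₁) ψ₂ _ x))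
  }
  where open IsMonoid isMonoid using (assoc; identityˡ; identityʳ)
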